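{- Let $n,d,k$ be positive integers and $\varepsilon>0$. Let $\Pi$ be a planar property of $n$-vertex graphs with maximum degree at most $d$. Let $G$ be an $n$-vertex graph with maximum degree at most $d$, and let $P$ be an $(\varepsilon,k)$-partition of $G$. Then: (i) if $G\in\Pi$, then $\mathrm{cnt}(P)\in\boldsymbol{C}_\Pi$; (ii) if $G$ is $3\varepsilon$-far from $\Pi$, then $\|\mathrm{cnt}(P)-\boldsymbol v\|_1>\varepsilon n/(kd)$ for every $\boldsymbol v\in\boldsymbol{C}_\Pi$.
   Context: A planar property $\Pi$ is a set of unlabeled planar graphs; $G\in\Pi$ means $G$ is isomorphic to a member of $\Pi$. The distance between two $n$-vertex graphs of maximum degree at most $d$ is the minimum number of edge insertions and deletions making one isomorphic to the other, divided by $dn$. The distance of $G$ to $\Pi$ is the minimum of its distance to members of $\Pi$; $G$ is $\delta$-far from $\Pi$ if this exceeds $\delta$. An $(\varepsilon,k)$-partition of a graph $F$ on $n$ vertices with degree bound $d$ is a graph $F'$ obtained from $F$ by deleting at most $\varepsilon dn$ edges, such that every connected component of $F'$ has at most $k$ vertices. For a graph $G'$ whose components all have at most $k$ vertices, $\mathrm{cnt}(G')$ is the vector indexed by isomorphism classes $F$ of connected graphs with at most $k$ vertices; its $F$-entry is the number of components of $G'$ isomorphic to $F$. $\boldsymbol{C}_\Pi$ is the set of all vectors $\mathrm{cnt}(F')$, where $F\in\Pi$ and $F'$ is an $(\varepsilon,k)$-partition of $F$.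
   Formalization: The parameter ε ranges over the positive rationals. -}

module Defs where

open import Data.Nat as ℕ using (ℕ; zero; suc; _+_; _*_; _≤_; ∣_-_∣)
open import Data.Fin as Fin using (Fin; _<?_)
open import Data.Bool using (Bool; true; false; if_then_else_; _∧_; not; _xor_)
open import Data.Product using (Σ; ∃; _×_; _,_; proj₁; proj₂)
open import Data.Empty using (⊥)
open import Data.Integer using (+_)
open import Data.Rational as ℚ using (ℚ; _/_)
open import Relation.Nullary.Decidable using (⌊_⌋)
open import Relation.Binary.PropositionalEquality using (_≡_)
open import Relation.Binary.Construct.Closure.ReflexiveTransitive using (Star)
open import Function.Definitions using (Injective)
open import Function.Bundles using (_↔_; Inverse)

toℚ : ℕ → ℚ
toℚ n = + n / 1

iter : ∀ {A : Set} → (A → A) → ℕ → A → A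
iter f zero    x = x
iter f (suc j) x = f (iter f j x)

sumᶠ : ∀ {n} → (Fin n → ℕ) → ℕ
sumᶠ {zero}  f = 0
sumᶠ {suc n} f = f Fin.zero + sumᶠ (λ i → f (Fin.suc i))

countᶠ : ∀ {n} → (Fin n → Bool) → ℕ
countᶠ p = sumᶠ (λ i → if p i then 1 else 0)

countPairs : ∀ {n} → (Fin n → Fin n → Bool) → ℕ
countPairs p = sumᶠ (λ i → countᶠ (λ j → ⌊ i <? j ⌋ ∧ p i j))

-- Count P c : the set {v : Fin n | P v} has exactly c elements
-- (an injective enumeration Fin c → Fin n of exactly its elements)
Count : ∀ {n} → (Fin n → Set) → ℕ → Set
Count {n} P c =
  Σ (Fin c → Fin n) λ f →
    Injective _≡_ _≡_ f × (∀ a → P (f a)) × (∀ v → P v → ∃ λ a → f a ≡ v)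

record Graph (n : ℕ) : Set where
  field
    adj    : Fin n → Fin n → Bool
    sym    : ∀ i j → adj i j ≡ adj j i
    irrefl : ∀ i → adj i i ≡ false
open Graph public

E : ∀ {n} → Graph n → Fin n → Fin n → Set
E G i j = adj G i j ≡ true

Reach : ∀ {n} → Graph n → Fin n → Fin n → Set
Reach G = Star (E G)

numEdges : ∀ {n} → Graph n → ℕ
numEdges G = countPairs (adj G)

degree : ∀ {n} → Graph n → Fin n → ℕ
degree G v = countᶠ (adj G v)

MaxDeg≤ : ∀ {n} → ℕ → Graph n → Set
MaxDeg≤ d G = ∀ v → degree G v ≤ d

Iso : ∀ {m m'} → Graph m → Graph m' → Set
Iso {m} {m'} G H =
  Σ (Fin m ↔ Fin m') λ π →
    ∀ i j → adj G i j ≡ adj H (Inverse.to π i) (Inverse.to π j)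

ConnectedGraph : ∀ {m} → Graph m → Set
ConnectedGraph {m} H = (1 ≤ m) × (∀ a b → Reach H a b)

Leader : ∀ {n} → Graph n → Fin n → Set
Leader G v = ∀ w → Reach G v w → v Fin.≤ w

Isolated : ∀ {n} → Graph n → Fin n → Set
Isolated G v = ∀ w → adj G v w ≡ false

-- Planarity (combinatorial embeddings / rotation systems,
-- Heffter–Edmonds–Ringel): G is planar iff it has a rotation system
-- whose every component has Euler characteristic 2 (genus 0).

-- ρ v is a cyclic permutation of the neighbourhood of v
RotationSystem : ∀ {n} → Graph n → (Fin n → Fin n → Fin n) → Set
RotationSystem G ρ =
  (∀ v u → E G v u → E G v (ρ v u)) ×
  (∀ v u w → E G v u → E G v w → ∃ λ j → iter (ρ v) j u ≡ w)

Dart : ∀ {n} → Graph n → Fin n × Fin n → Set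
Dart G x = E G (proj₁ x) (proj₂ x)

faceMap : ∀ {n} → (Fin n → Fin n → Fin n) → Fin n × Fin n → Fin n × Fin n
faceMap ρ (u , v) = (v , ρ v u)

-- the face-tracing permutation has exactly f orbits on the darts of G
NumFaces : ∀ {n} → Graph n → (Fin n → Fin n → Fin n) → ℕ → Set
NumFaces {n} G ρ f =
  Σ (Fin f → Fin n × Fin n) λ r →
    (∀ i → Dart G (r i)) ×
    (∀ x → Dart G x → ∃ λ i → ∃ λ j → iter (faceMap ρ) j (r i) ≡ x) ×
    (∀ i i' j → iter (faceMap ρ) j (r i) ≡ r i' → i ≡ i')

-- Euler's formula, summed over components: a component with at least one
-- edge contributes V - E + F = 2, an isolated vertex contributes 1
-- (it has no darts, hence no face orbits).
Planar : ∀ {n} → Graph n → Set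
Planar {n} G =
  Σ (Fin n → Fin n → Fin n) λ ρ → RotationSystem G ρ ×
  Σ ℕ λ f → Σ ℕ λ c → Σ ℕ λ c₀ →
    NumFaces G ρ f × Count (Leader G) c × Count (Isolated G) c₀ ×
    (n + f + c₀ ≡ numEdges G + 2 * c)

Property : ℕ → Set₁
Property n = Graph n → Set

_∈Π_ : ∀ {n} → Graph n → Property n → Set
G ∈Π Π = ∃ λ H → Π H × Iso G H

diffUnder : ∀ {n} → Graph n → Graph n → (Fin n ↔ Fin n) → ℕ
diffUnder G H π =
  countPairs (λ i j → adj G i j xor adj H (Inverse.to π i) (Inverse.to π j))

Far : ∀ {n} → ℚ → ℕ → Property n → Graph n → Set
Far {n} δ d Π G =
  ∀ H → Π H → ∀ (π : Fin n ↔ Fin n) →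
    δ ℚ.* toℚ (d * n) ℚ.< toℚ (diffUnder G H π)

IsPartition : ∀ {n} → ℚ → ℕ → ℕ → Graph n → Graph n → Set
IsPartition {n} ε d k F F' =
  (∀ i j → E F' i j → E F i j) ×
  (toℚ (countPairs (λ i j → adj F i j ∧ not (adj F' i j)))
     ℚ.≤ ε ℚ.* toℚ (d * n)) ×
  (∀ v (S : Fin (suc k) → Fin n) → Injective _≡_ _≡_ S →
     (∀ a → Reach F' v (S a)) → ⊥)

CompIso : ∀ {n m} → Graph n → Fin n → Graph m → Set
CompIso {n} {m} G v H =
  Σ (Fin m → Fin n) λ f →
    Injective _≡_ _≡_ f × (∀ a → Reach G v (f a)) ×
    (∀ w → Reach G v w → ∃ λ a → f a ≡ w) ×
    (∀ a b → adj H a b ≡ adj G (f a) (f b))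

-- CompCount G H c : the H-entry of cnt(G) is c
-- (G has exactly c components isomorphic to H)
CompCount : ∀ {n m} → Graph n → Graph m → ℕ → Set
CompCount G H c = Count (λ v → Leader G v × CompIso G v H) c

-- cnt(G₁) = cnt(G₂) for the index set of connected graphs on ≤ k vertices
SameCnt : ∀ {n₁ n₂} → ℕ → Graph n₁ → Graph n₂ → Set
SameCnt k G₁ G₂ =
  ∀ m (H : Graph m) → m ≤ k → ConnectedGraph H →
    ∀ a b → CompCount G₁ H a → CompCount G₂ H b → a ≡ b

-- a system of representatives of the isomorphism classes of connected
-- graphs with at most k vertices (the index set of cnt vectors)
record ClassReps (k : ℕ) : Set where
  field
    r        : ℕ
    size     : Fin r → ℕ
    rep      : (i : Fin r) → Graph (size i)
    size≤k   : ∀ i → size i ≤ k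
    conn     : ∀ i → ConnectedGraph (rep i)
    distinct : ∀ i j → Iso (rep i) (rep j) → i ≡ j
    complete : ∀ m (H : Graph m) → m ≤ k → ConnectedGraph H →
               ∃ λ i → Iso H (rep i)
open ClassReps public

-- ‖cnt(G₁) - cnt(G₂)‖₁ > t / s   (t rational, s natural; stated as
-- t < ‖cnt(G₁) - cnt(G₂)‖₁ · s to avoid dividing)
L1DistGreater : ∀ {n₁ n₂} → ℕ → Graph n₁ → Graph n₂ → ℚ → ℕ → Set
L1DistGreater k G₁ G₂ t s =
  (R : ClassReps k) → (a b : Fin (r R) → ℕ) →
  (∀ i → CompCount G₁ (rep R i) (a i)) →
  (∀ i → CompCount G₂ (rep R i) (b i)) →
  t ℚ.< toℚ (sumᶠ (λ i → ∣ a i - b i ∣) * s)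

{-# OPTIONS --safe #-}
module Submission where

-- (i) An isomorphism from G onto a member F of Π carries P to an (ε,k)-partition of F with the
-- same component counts.
-- (ii) Let a and b be the count vectors of P and of a partition F′ of some F ∈ Π. Pair off aᵢ ⊓ bᵢ
-- components of each type of P with components of F′ of the same type and extend this pairing to a
-- vertex bijection π. Along π, every pair on which P and F′ differ has both ends among the at most
-- ‖a − b‖₁·k/2 unmatched vertices, each lying in at most 2d such pairs; so P and F′ differ in at
-- most ‖a − b‖₁·kd/2 pairs. If ‖a − b‖₁·kd ≤ εn, the triangle inequality through P and F′ puts G
-- within εdn + εn/2 + εdn < 3εdn edits of F.

open import Data.Bool using (Bool; true; false; if_then_else_; _∧_; _∨_; not; _xor_)
import Data.Bool as Bool
open import Data.Bool.Properties using (xor-same; xor-comm; xor-identityʳ; ∧-identityʳ; ¬-not)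
open import Data.Empty using (⊥; ⊥-elim)
open import Data.Fin as Fin using (Fin; toℕ; _<?_)
import Data.Fin.Properties as FinP
open import Data.Fin.Permutation as Perm using (Permutation; _⟨$⟩ʳ_; _⟨$⟩ˡ_)
import Data.Fin.Permutation.Components as PC
open import Data.Integer using (+_)
import Data.Integer as ℤ
import Data.Integer.Properties as ℤP
open import Data.Nat as ℕ using (ℕ; zero; suc; _+_; _*_; _∸_; _≤_; _<_; z≤n; s≤s; _⊓_; ∣_-_∣)
import Data.Nat.Properties as ℕP
import Data.Nat.Coprimality as Coprimality
open import Data.Product using (Σ; ∃; _×_; _,_; proj₁; proj₂)
open import Data.Rational as ℚ using (ℚ; _/_; 0ℚ)
import Data.Rational.Properties as ℚP
open import Data.Rational.Solver using () renaming (module +-*-Solver to ℚ-Solver)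
open import Data.Nat.Solver using () renaming (module +-*-Solver to ℕ-Solver)
import Data.Rational.Unnormalised as ℚᵘ
import Data.Rational.Unnormalised.Properties as ℚᵘP
import Data.Sign as Sign
open import Data.Sum using (_⊎_; inj₁; inj₂)
open import Function.Bundles using (Injection; mk↔ₛ′)
open import Function.Properties.Inverse using (↔⇒↣)
open import Function.Base using (_∘_)
open import Function.Definitions using (Injective)
open import Relation.Binary.Construct.Closure.ReflexiveTransitive as Star using (Star; ε; _◅_; _◅◅_)
open import Relation.Binary.Definitions using (tri<; tri≈; tri>)
open import Relation.Binary.PropositionalEquality
open import Relation.Nullary using (yes; no; ¬_; Dec)
open import Relation.Nullary.Decidable using (⌊_⌋; dec-true; dec-false; decidable-stable)
import Algebra.Properties.CommutativeMonoid.Sum as CommutativeMonoidSum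

open import Defs renaming (sym to adj-sym)

module ℕSum = CommutativeMonoidSum ℕP.+-0-commutativeMonoid

toℚ≡mkℚ : ∀ n → toℚ n ≡ ℚ.mkℚ (+ n) 0 (Coprimality.sym (Coprimality.1-coprimeTo n))
toℚ≡mkℚ n = ℚP.↥p/↧p≡p _

toℚ-mono-≤ : ∀ {m n} → m ≤ n → toℚ m ℚ.≤ toℚ n
toℚ-mono-≤ {m} {n} m≤n rewrite toℚ≡mkℚ m | toℚ≡mkℚ n =
  ℚ.*≤* (subst₂ ℤ._≤_ (sym (ℤP.*-identityʳ (+ m))) (sym (ℤP.*-identityʳ (+ n))) (ℤ.+≤+ m≤n))

toℚ-+ : ∀ m n → toℚ (m + n) ≡ toℚ m ℚ.+ toℚ n
toℚ-+ m n = ℚP.toℚᵘ-injective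
  (ℚᵘP.≃-trans unnormalised (ℚᵘP.≃-sym (ℚP.toℚᵘ-homo-+ (toℚ m) (toℚ n))))
  where
  unnormalised : ℚ.toℚᵘ (toℚ (m + n)) ℚᵘ.≃ ℚ.toℚᵘ (toℚ m) ℚᵘ.+ ℚ.toℚᵘ (toℚ n)
  unnormalised rewrite toℚ≡mkℚ m | toℚ≡mkℚ n | toℚ≡mkℚ (m + n) =
    ℚᵘ.*≡* (trans (ℤP.*-identityʳ _) (trans numerators (sym (ℤP.*-identityʳ _))))
    where
    numerators : + (m + n) ≡ (Sign.+ ℤ.◃ m * 1) ℤ.+ (Sign.+ ℤ.◃ n * 1)
    numerators rewrite ℤP.+◃n≡+n (m * 1) | ℤP.+◃n≡+n (n * 1)
                     | ℕP.*-identityʳ m | ℕP.*-identityʳ n = refl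

2x≤5e⇒x≯3e : ∀ e {x a t b} → 0ℚ ℚ.≤ e →
  toℚ a ℚ.≤ e → toℚ t ℚ.≤ e → toℚ b ℚ.≤ e →
  x + x ≤ (a + a) + t + (b + b) → ¬ ((+ 3 / 1) ℚ.* e ℚ.< toℚ x)
2x≤5e⇒x≯3e e {x} {a} {t} {b} 0≤e a≤e t≤e b≤e 2x≤ 3e<x = ℚP.<-irrefl refl (begin-strict
  3e ℚ.+ 3e
    <⟨ ℚP.+-mono-< 3e<x 3e<x ⟩
  toℚ x ℚ.+ toℚ x
    ≡⟨ toℚ-+ x x ⟨
  toℚ (x + x)
    ≤⟨ toℚ-mono-≤ 2x≤ ⟩
  toℚ ((a + a) + t + (b + b))
    ≡⟨ expand ⟩
  (toℚ a ℚ.+ toℚ a ℚ.+ toℚ t) ℚ.+ (toℚ b ℚ.+ toℚ b)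
    ≤⟨ ℚP.+-mono-≤ (ℚP.+-mono-≤ (ℚP.+-mono-≤ a≤e a≤e) t≤e) (ℚP.+-mono-≤ b≤e b≤e) ⟩
  (e ℚ.+ e ℚ.+ e) ℚ.+ (e ℚ.+ e)
    ≤⟨ ℚP.+-monoʳ-≤ (e ℚ.+ e ℚ.+ e) 2e≤3e ⟩
  (e ℚ.+ e ℚ.+ e) ℚ.+ (e ℚ.+ e ℚ.+ e)
    ≡⟨ cong (λ z → z ℚ.+ z) three-times ⟨
  3e ℚ.+ 3e
    ∎)
  where
  open ℚP.≤-Reasoning
  open ℚ-Solver
  3e : ℚ
  3e = (+ 3 / 1) ℚ.* e
  three-times : 3e ≡ e ℚ.+ e ℚ.+ e
  three-times = solve 1 (λ e → con (+ 3 / 1) :* e := e :+ e :+ e) refl e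
  2e≤3e : e ℚ.+ e ℚ.≤ e ℚ.+ e ℚ.+ e
  2e≤3e = subst (ℚ._≤ e ℚ.+ e ℚ.+ e) (ℚP.+-identityʳ (e ℚ.+ e)) (ℚP.+-monoʳ-≤ (e ℚ.+ e) 0≤e)
  expand : toℚ ((a + a) + t + (b + b)) ≡ (toℚ a ℚ.+ toℚ a ℚ.+ toℚ t) ℚ.+ (toℚ b ℚ.+ toℚ b)
  expand = trans (toℚ-+ (a + a + t) (b + b))
    (cong₂ ℚ._+_ (trans (toℚ-+ (a + a) t) (cong (ℚ._+ toℚ t) (toℚ-+ a a))) (toℚ-+ b b))

isYes-true : ∀ {A : Set} (a? : Dec A) → A → ⌊ a? ⌋ ≡ true
isYes-true (yes _) _ = refl
isYes-true (no ¬a) a = ⊥-elim (¬a a)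

isYes-false : ∀ {A : Set} (a? : Dec A) → ¬ A → ⌊ a? ⌋ ≡ false
isYes-false (yes a) ¬a = ⊥-elim (¬a a)
isYes-false (no _) _ = refl

isYes-⇔ : ∀ {A B : Set} (a? : Dec A) (b? : Dec B) → (A → B) → (B → A) → ⌊ a? ⌋ ≡ ⌊ b? ⌋
isYes-⇔ a? b? A→B B→A with a?
... | yes a = sym (isYes-true b? (A→B a))
... | no ¬a = sym (isYes-false b? (λ b → ¬a (B→A b)))

𝟙 : Bool → ℕ
𝟙 b = if b then 1 else 0

𝟙-mono : ∀ {x y} → (x ≡ true → y ≡ true) → 𝟙 x ≤ 𝟙 y
𝟙-mono {false} _ = z≤n
𝟙-mono {true} x⇒y rewrite x⇒y refl = ℕP.≤-refl

sumᶠ≡sum : ∀ {n} (f : Fin n → ℕ) → sumᶠ f ≡ ℕSum.sum f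
sumᶠ≡sum {zero} f = refl
sumᶠ≡sum {suc n} f = cong (λ s → f Fin.zero + s) (sumᶠ≡sum (λ i → f (Fin.suc i)))

sumᶠ-cong : ∀ {n} {f g : Fin n → ℕ} → (∀ i → f i ≡ g i) → sumᶠ f ≡ sumᶠ g
sumᶠ-cong {zero} f≗g = refl
sumᶠ-cong {suc n} f≗g = cong₂ _+_ (f≗g Fin.zero) (sumᶠ-cong (λ i → f≗g (Fin.suc i)))

sumᶠ-mono-≤ : ∀ {n} {f g : Fin n → ℕ} → (∀ i → f i ≤ g i) → sumᶠ f ≤ sumᶠ g
sumᶠ-mono-≤ {zero} f≤g = z≤n
sumᶠ-mono-≤ {suc n} f≤g = ℕP.+-mono-≤ (f≤g Fin.zero) (sumᶠ-mono-≤ (λ i → f≤g (Fin.suc i)))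

sumᶠ-mono-< : ∀ {n} {f g : Fin n → ℕ} → (∀ i → f i ≤ g i) → ∀ i₀ → f i₀ < g i₀ → sumᶠ f < sumᶠ g
sumᶠ-mono-< {suc n} f≤g Fin.zero fi₀<gi₀ =
  ℕP.+-mono-<-≤ fi₀<gi₀ (sumᶠ-mono-≤ (λ i → f≤g (Fin.suc i)))
sumᶠ-mono-< {suc n} f≤g (Fin.suc i₀) fi₀<gi₀ =
  ℕP.+-mono-≤-< (f≤g Fin.zero) (sumᶠ-mono-< (λ i → f≤g (Fin.suc i)) i₀ fi₀<gi₀)

sumᶠ-≤-* : ∀ {n} {f : Fin n → ℕ} c → (∀ i → f i ≤ c) → sumᶠ f ≤ n * c
sumᶠ-≤-* {zero} c f≤c = z≤n
sumᶠ-≤-* {suc n} c f≤c = ℕP.+-mono-≤ (f≤c Fin.zero) (sumᶠ-≤-* c (λ i → f≤c (Fin.suc i)))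

sumᶠ-*ˡ : ∀ {n} c (f : Fin n → ℕ) → sumᶠ (λ i → c * f i) ≡ c * sumᶠ f
sumᶠ-*ˡ {zero} c f = sym (ℕP.*-zeroʳ c)
sumᶠ-*ˡ {suc n} c f =
  trans (cong (λ s → c * f Fin.zero + s) (sumᶠ-*ˡ c (λ i → f (Fin.suc i))))
        (sym (ℕP.*-distribˡ-+ c (f Fin.zero) _))

sumᶠ-*ʳ : ∀ {n} c (f : Fin n → ℕ) → sumᶠ (λ i → f i * c) ≡ sumᶠ f * c
sumᶠ-*ʳ c f = trans (sumᶠ-cong (λ i → ℕP.*-comm (f i) c)) (trans (sumᶠ-*ˡ c f) (ℕP.*-comm c (sumᶠ f)))

sumᶠ-+ : ∀ {n} (f g : Fin n → ℕ) → sumᶠ (λ i → f i + g i) ≡ sumᶠ f + sumᶠ g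
sumᶠ-+ f g = begin
  sumᶠ (λ i → f i + g i)         ≡⟨ sumᶠ≡sum (λ i → f i + g i) ⟩
  ℕSum.sum (λ i → f i + g i)     ≡⟨ ℕSum.∑-distrib-+ f g ⟩
  ℕSum.sum f + ℕSum.sum g        ≡⟨ cong₂ _+_ (sumᶠ≡sum f) (sumᶠ≡sum g) ⟨
  sumᶠ f + sumᶠ g                ∎
  where open ≡-Reasoning

sumᶠ-comm : ∀ {m n} (f : Fin m → Fin n → ℕ) →
  sumᶠ (λ i → sumᶠ (λ j → f i j)) ≡ sumᶠ (λ j → sumᶠ (λ i → f i j))
sumᶠ-comm f = begin
  sumᶠ (λ i → sumᶠ (λ j → f i j))              ≡⟨ sumᶠ-cong (λ i → sumᶠ≡sum (f i)) ⟩
  sumᶠ (λ i → ℕSum.sum (λ j → f i j))          ≡⟨ sumᶠ≡sum (λ i → ℕSum.sum (λ j → f i j)) ⟩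
  ℕSum.sum (λ i → ℕSum.sum (λ j → f i j))      ≡⟨ ℕSum.∑-comm f ⟩
  ℕSum.sum (λ j → ℕSum.sum (λ i → f i j))      ≡⟨ sumᶠ≡sum (λ j → ℕSum.sum (λ i → f i j)) ⟨
  sumᶠ (λ j → ℕSum.sum (λ i → f i j))          ≡⟨ sumᶠ-cong (λ j → sumᶠ≡sum (λ i → f i j)) ⟨
  sumᶠ (λ j → sumᶠ (λ i → f i j))              ∎
  where open ≡-Reasoning

sumᶠ-permute : ∀ {n} (π : Permutation n n) (f : Fin n → ℕ) → sumᶠ (λ i → f (π ⟨$⟩ʳ i)) ≡ sumᶠ f
sumᶠ-permute π f = begin
  sumᶠ (λ i → f (π ⟨$⟩ʳ i))      ≡⟨ sumᶠ≡sum (λ i → f (π ⟨$⟩ʳ i)) ⟩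
  ℕSum.sum (λ i → f (π ⟨$⟩ʳ i))  ≡⟨ ℕSum.sum-permute f π ⟨
  ℕSum.sum f                     ≡⟨ sumᶠ≡sum f ⟨
  sumᶠ f                         ∎
  where open ≡-Reasoning

countᶠ-mono-≤ : ∀ {n} {p q : Fin n → Bool} → (∀ i → p i ≡ true → q i ≡ true) → countᶠ p ≤ countᶠ q
countᶠ-mono-≤ p⇒q = sumᶠ-mono-≤ (λ i → 𝟙-mono (p⇒q i))

countᶠ-mono-< : ∀ {n} {p q : Fin n → Bool} → (∀ i → p i ≡ true → q i ≡ true) →
  ∀ i₀ → p i₀ ≡ false → q i₀ ≡ true → countᶠ p < countᶠ q
countᶠ-mono-< p⇒q i₀ pi₀≡false qi₀≡true =
  sumᶠ-mono-< (λ i → 𝟙-mono (p⇒q i)) i₀ (subst₂ (λ x y → 𝟙 x < 𝟙 y) (sym pi₀≡false) (sym qi₀≡true) ℕP.≤-refl)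

countᶠ≤n : ∀ {n} (p : Fin n → Bool) → countᶠ p ≤ n
countᶠ≤n {n} p = subst (countᶠ p ≤_) (ℕP.*-identityʳ n) (sumᶠ-≤-* 1 (λ i → 𝟙≤1 (p i)))
  where
  𝟙≤1 : ∀ b → 𝟙 b ≤ 1
  𝟙≤1 true = ℕP.≤-refl
  𝟙≤1 false = z≤n

countᶠ-pos : ∀ {n} (p : Fin n → Bool) i → p i ≡ true → 0 < countᶠ p
countᶠ-pos p Fin.zero pi≡true rewrite pi≡true = s≤s z≤n
countᶠ-pos p (Fin.suc i) pi≡true =
  ℕP.<-≤-trans (countᶠ-pos (λ i → p (Fin.suc i)) i pi≡true) (ℕP.m≤n+m _ (𝟙 (p Fin.zero)))

countᶠ-toℕ≥ : ∀ n m → countᶠ {n} (λ x → ⌊ m ℕP.≤? toℕ x ⌋) ≡ n ∸ m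
countᶠ-toℕ≥ zero m = sym (ℕP.0∸n≡0 m)
countᶠ-toℕ≥ (suc n) zero = cong suc (trans (sumᶠ-cong {n} λ x →
  cong 𝟙 (isYes-⇔ (0 ℕP.≤? suc (toℕ x)) (0 ℕP.≤? toℕ x) (λ _ → z≤n) (λ _ → z≤n))) (countᶠ-toℕ≥ n 0))
countᶠ-toℕ≥ (suc n) (suc m) = trans (sumᶠ-cong {n} λ x →
  cong 𝟙 (isYes-⇔ (suc m ℕP.≤? suc (toℕ x)) (m ℕP.≤? toℕ x) ℕ.s≤s⁻¹ s≤s)) (countᶠ-toℕ≥ n m)

countOrdered : ∀ {n} → (Fin n → Fin n → Bool) → ℕ
countOrdered q = sumᶠ (λ i → countᶠ (q i))

countOrdered-cong : ∀ {n} {q q′ : Fin n → Fin n → Bool} → (∀ i j → q i j ≡ q′ i j) →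
  countOrdered q ≡ countOrdered q′
countOrdered-cong q≗q′ = sumᶠ-cong (λ i → sumᶠ-cong (λ j → cong 𝟙 (q≗q′ i j)))

countOrdered-permute : ∀ {n} (π : Permutation n n) (q : Fin n → Fin n → Bool) →
  countOrdered (λ i j → q (π ⟨$⟩ʳ i) (π ⟨$⟩ʳ j)) ≡ countOrdered q
countOrdered-permute π q =
  trans (sumᶠ-cong (λ i → sumᶠ-permute π (λ j → 𝟙 (q (π ⟨$⟩ʳ i) j))))
        (sumᶠ-permute π (λ i → countᶠ (q i)))

countOrdered-subadditive : ∀ {n} {q q₁ q₂ : Fin n → Fin n → Bool} →
  (∀ i j → 𝟙 (q i j) ≤ 𝟙 (q₁ i j) + 𝟙 (q₂ i j)) →
  countOrdered q ≤ countOrdered q₁ + countOrdered q₂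
countOrdered-subadditive {n} {q} {q₁} {q₂} q≤q₁+q₂ = begin
  countOrdered q
    ≤⟨ sumᶠ-mono-≤ {n} (λ i → sumᶠ-mono-≤ {n} (q≤q₁+q₂ i)) ⟩
  sumᶠ (λ i → sumᶠ (λ j → 𝟙 (q₁ i j) + 𝟙 (q₂ i j)))
    ≡⟨ sumᶠ-cong {n} (λ i → sumᶠ-+ (λ j → 𝟙 (q₁ i j)) (λ j → 𝟙 (q₂ i j))) ⟩
  sumᶠ (λ i → countᶠ (q₁ i) + countᶠ (q₂ i))
    ≡⟨ sumᶠ-+ (λ i → countᶠ (q₁ i)) (λ i → countᶠ (q₂ i)) ⟩
  countOrdered q₁ + countOrdered q₂
    ∎
  where open ℕP.≤-Reasoning

countOrdered≡2*countPairs : ∀ {n} (q : Fin n → Fin n → Bool) →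
  (∀ i j → q i j ≡ q j i) → (∀ i → q i i ≡ false) → countOrdered q ≡ 2 * countPairs q
countOrdered≡2*countPairs {n} q q-sym q-irrefl = begin
  countOrdered q
    ≡⟨ sumᶠ-cong {n} (λ i → sumᶠ-cong {n} (split i)) ⟩
  sumᶠ (λ i → sumᶠ (λ j → 𝟙 (above i j) + 𝟙 (below i j)))
    ≡⟨ sumᶠ-cong {n} (λ i → sumᶠ-+ (λ j → 𝟙 (above i j)) (λ j → 𝟙 (below i j))) ⟩
  sumᶠ (λ i → countᶠ (above i) + countᶠ (below i))
    ≡⟨ sumᶠ-+ (λ i → countᶠ (above i)) (λ i → countᶠ (below i)) ⟩
  countPairs q + sumᶠ (λ i → countᶠ (below i))
    ≡⟨ cong (λ s → countPairs q + s) (sumᶠ-comm (λ i j → 𝟙 (below i j))) ⟩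
  countPairs q + countPairs q
    ≡⟨ cong (λ s → countPairs q + s) (ℕP.+-identityʳ _) ⟨
  2 * countPairs q
    ∎
  where
  open ≡-Reasoning
  above below : Fin n → Fin n → Bool
  above i j = ⌊ i <? j ⌋ ∧ q i j
  below i j = ⌊ j <? i ⌋ ∧ q j i
  split : ∀ i j → 𝟙 (q i j) ≡ 𝟙 (above i j) + 𝟙 (below i j)
  split i j with FinP.<-cmp i j
  ... | tri< i<j _ j≮i rewrite isYes-true (i <? j) i<j | isYes-false (j <? i) j≮i = sym (ℕP.+-identityʳ _)
  ... | tri≈ i≮j refl _ rewrite isYes-false (i <? i) i≮j | q-irrefl i = refl
  ... | tri> i≮j _ j<i rewrite isYes-false (i <? j) i≮j | isYes-true (j <? i) j<i = cong 𝟙 (q-sym i j)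

countPairs-cong : ∀ {n} {q q′ : Fin n → Fin n → Bool} → (∀ i j → q i j ≡ q′ i j) →
  countPairs q ≡ countPairs q′
countPairs-cong q≗q′ = sumᶠ-cong (λ i → sumᶠ-cong (λ j → cong (λ b → 𝟙 (⌊ i <? j ⌋ ∧ b)) (q≗q′ i j)))

countPairs-permute : ∀ {n} (π : Permutation n n) (q : Fin n → Fin n → Bool) →
  (∀ i j → q i j ≡ q j i) → (∀ i → q i i ≡ false) →
  countPairs (λ i j → q (π ⟨$⟩ʳ i) (π ⟨$⟩ʳ j)) ≡ countPairs q
countPairs-permute {n} π q q-sym q-irrefl = ℕP.*-cancelˡ-≡ _ _ 2 (begin
  2 * countPairs qπ   ≡⟨ countOrdered≡2*countPairs qπ (λ i j → q-sym _ _) (λ i → q-irrefl _) ⟨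
  countOrdered qπ     ≡⟨ countOrdered-permute π q ⟩
  countOrdered q      ≡⟨ countOrdered≡2*countPairs q q-sym q-irrefl ⟩
  2 * countPairs q    ∎)
  where
  open ≡-Reasoning
  qπ : Fin n → Fin n → Bool
  qπ i j = q (π ⟨$⟩ʳ i) (π ⟨$⟩ʳ j)

⟨$⟩ʳ-injective : ∀ {m n} (π : Permutation m n) → Injective _≡_ _≡_ (π ⟨$⟩ʳ_)
⟨$⟩ʳ-injective π = Injection.injective (↔⇒↣ π)

⟨$⟩ˡ-injective : ∀ {m n} (π : Permutation m n) → Injective _≡_ _≡_ (π ⟨$⟩ˡ_)
⟨$⟩ˡ-injective π = Injection.injective (↔⇒↣ (Perm.flip π))

transpose-hit : ∀ {n} (i j : Fin n) → PC.transpose i j i ≡ j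
transpose-hit i j rewrite dec-true (i FinP.≟ i) refl = refl

transpose-fix : ∀ {n} (i j k : Fin n) → k ≢ i → k ≢ j → PC.transpose i j k ≡ k
transpose-fix i j k k≢i k≢j rewrite dec-false (k FinP.≟ i) k≢i | dec-false (k FinP.≟ j) k≢j = refl

-- By induction on m: extend the restriction of s to the first m points, then transpose the
-- image of the last point into place.
extend-to-permutation : ∀ {m n} (s : Fin m → Fin n) → Injective _≡_ _≡_ s → (m≤n : m ≤ n) →
  Σ (Permutation n n) λ p → ∀ j → p ⟨$⟩ʳ Fin.inject≤ j m≤n ≡ s j
extend-to-permutation {zero} s s-inj m≤n = Perm.id , λ ()
extend-to-permutation {suc m} {n} s s-inj 1+m≤n = p , p-extends
  where
  m≤n : m ≤ n
  m≤n = ℕP.≤-trans (ℕP.n≤1+n m) 1+m≤n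
  s′ : Fin m → Fin n
  s′ j = s (Fin.inject₁ j)
  IH : Σ (Permutation n n) λ q → ∀ j → q ⟨$⟩ʳ Fin.inject≤ j m≤n ≡ s′ j
  IH = extend-to-permutation s′ (λ eq → FinP.inject₁-injective (s-inj eq)) m≤n
  p′ : Permutation n n
  p′ = proj₁ IH
  last : Fin n
  last = Fin.inject≤ (Fin.fromℕ m) 1+m≤n
  y : Fin n
  y = p′ ⟨$⟩ˡ s (Fin.fromℕ m)
  p : Permutation n n
  p = Perm.transpose last y Perm.∘ₚ p′
  toℕ-last : toℕ last ≡ m
  toℕ-last = trans (FinP.toℕ-inject≤ _ 1+m≤n) (FinP.toℕ-fromℕ m)
  p-last : p ⟨$⟩ʳ last ≡ s (Fin.fromℕ m)
  p-last = trans (cong (p′ ⟨$⟩ʳ_) (transpose-hit last y)) (Perm.inverseʳ p′)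
  p-earlier : ∀ j → p ⟨$⟩ʳ Fin.inject≤ (Fin.inject₁ j) 1+m≤n ≡ s (Fin.inject₁ j)
  p-earlier j = trans (cong (p′ ⟨$⟩ʳ_) (transpose-fix last y z z≢last z≢y)) p′z≡s′j
    where
    z : Fin n
    z = Fin.inject≤ (Fin.inject₁ j) 1+m≤n
    toℕ-z : toℕ z ≡ toℕ j
    toℕ-z = trans (FinP.toℕ-inject≤ _ 1+m≤n) (FinP.toℕ-inject₁ j)
    z≡ : z ≡ Fin.inject≤ j m≤n
    z≡ = FinP.toℕ-injective (trans toℕ-z (sym (FinP.toℕ-inject≤ j m≤n)))
    p′z≡s′j : p′ ⟨$⟩ʳ z ≡ s′ j
    p′z≡s′j = trans (cong (p′ ⟨$⟩ʳ_) z≡) (proj₂ IH j)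
    z≢last : z ≢ last
    z≢last eq = ℕP.<-irrefl (trans (sym toℕ-z) (trans (cong toℕ eq) toℕ-last)) (FinP.toℕ<n j)
    z≢y : z ≢ y
    z≢y eq = FinP.toℕ-inject₁-≢ j (sym (trans (cong toℕ (s-inj s′j≡s-last)) (FinP.toℕ-fromℕ m)))
      where
      s′j≡s-last : s′ j ≡ s (Fin.fromℕ m)
      s′j≡s-last = trans (sym p′z≡s′j) (trans (cong (p′ ⟨$⟩ʳ_) eq) (Perm.inverseʳ p′))
  p-extends : ∀ j → p ⟨$⟩ʳ Fin.inject≤ j 1+m≤n ≡ s j
  p-extends j with toℕ j ℕP.≟ m
  ... | yes j≡m = subst (λ z → p ⟨$⟩ʳ Fin.inject≤ z 1+m≤n ≡ s z)
                    (sym (FinP.toℕ-injective (trans j≡m (sym (FinP.toℕ-fromℕ m))))) p-last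
  ... | no j≢m = subst (λ z → p ⟨$⟩ʳ Fin.inject≤ z 1+m≤n ≡ s z)
                   (FinP.inject₁-lower₁ j (j≢m ∘ sym)) (p-earlier (Fin.lower₁ j (j≢m ∘ sym)))

record Alignment {M n} (f g : Fin M → Fin n) : Set where
  field
    perm          : Permutation n n
    aligns        : ∀ x → perm ⟨$⟩ʳ f x ≡ g x
    outside       : Fin n → Bool
    inside-image  : ∀ u → outside u ≡ false → ∃ λ x → f x ≡ u
    count-outside : countᶠ outside ≡ n ∸ M

align : ∀ {M n} (f g : Fin M → Fin n) → Injective _≡_ _≡_ f → Injective _≡_ _≡_ g → Alignment f g
align {M} {n} f g f-inj g-inj = record
  { perm = Perm.flip pf Perm.∘ₚ pg
  ; aligns = λ x → trans (cong (pg ⟨$⟩ʳ_) (pf⁻¹∘f x)) (pg-extends x)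
  ; outside = outside
  ; inside-image = inside-image
  ; count-outside = trans (sumᶠ-permute (Perm.flip pf) (λ x → 𝟙 ⌊ M ℕP.≤? toℕ x ⌋)) (countᶠ-toℕ≥ n M)
  }
  where
  M≤n = FinP.injective⇒≤ f-inj
  pf : Permutation n n
  pf = proj₁ (extend-to-permutation f f-inj M≤n)
  pf-extends : ∀ x → pf ⟨$⟩ʳ Fin.inject≤ x M≤n ≡ f x
  pf-extends = proj₂ (extend-to-permutation f f-inj M≤n)
  pg : Permutation n n
  pg = proj₁ (extend-to-permutation g g-inj M≤n)
  pg-extends : ∀ x → pg ⟨$⟩ʳ Fin.inject≤ x M≤n ≡ g x
  pg-extends = proj₂ (extend-to-permutation g g-inj M≤n)
  pf⁻¹∘f : ∀ x → pf ⟨$⟩ˡ f x ≡ Fin.inject≤ x M≤n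
  pf⁻¹∘f x = trans (cong (pf ⟨$⟩ˡ_) (sym (pf-extends x))) (Perm.inverseˡ pf)
  outside : Fin n → Bool
  outside u = ⌊ M ℕP.≤? toℕ (pf ⟨$⟩ˡ u) ⌋
  inside-image : ∀ u → outside u ≡ false → ∃ λ x → f x ≡ u
  inside-image u out≡false with M ℕP.≤? toℕ (pf ⟨$⟩ˡ u)
  inside-image u () | yes _
  ... | no M≰ = x , trans (sym (pf-extends x)) (trans (cong (pf ⟨$⟩ʳ_) inject≡) (Perm.inverseʳ pf))
    where
    below : toℕ (pf ⟨$⟩ˡ u) < M
    below = ℕP.≰⇒> M≰
    x : Fin M
    x = Fin.fromℕ< below
    inject≡ : Fin.inject≤ x M≤n ≡ pf ⟨$⟩ˡ u
    inject≡ = FinP.toℕ-injective (trans (FinP.toℕ-inject≤ x M≤n) (FinP.toℕ-fromℕ< below))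

E-sym : ∀ {n} (G : Graph n) {i j} → E G i j → E G j i
E-sym G {i} {j} e = trans (adj-sym G j i) e

Reach-sym : ∀ {n} (G : Graph n) {i j} → Reach G i j → Reach G j i
Reach-sym G = Star.reverse (E-sym G)

∨-true : ∀ {a b} → a ∨ b ≡ true → a ≡ true ⊎ b ≡ true
∨-true {true} _ = inj₁ refl
∨-true {false} b≡true = inj₂ b≡true

∨-trueˡ : ∀ {a} b → a ≡ true → a ∨ b ≡ true
∨-trueˡ b refl = refl

∨-trueʳ : ∀ a {b} → b ≡ true → a ∨ b ≡ true
∨-trueʳ true _ = refl
∨-trueʳ false b≡true = b≡true

∧-true : ∀ {a b} → a ∧ b ≡ true → a ≡ true × b ≡ true
∧-true {true} {true} _ = refl , refl

strictly-grew : ∀ {a b} → (a ≡ true → b ≡ true) → b ≢ a → a ≡ false × b ≡ true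
strictly-grew {false} {true} _ _ = refl , refl
strictly-grew {false} {false} _ b≢a = ⊥-elim (b≢a refl)
strictly-grew {true} a⇒b b≢a = ⊥-elim (b≢a (a⇒b refl))

anyᶠ : ∀ {n} → (Fin n → Bool) → Bool
anyᶠ {zero} p = false
anyᶠ {suc n} p = p Fin.zero ∨ anyᶠ (λ i → p (Fin.suc i))

anyᶠ-true⁺ : ∀ {n} (p : Fin n → Bool) i → p i ≡ true → anyᶠ p ≡ true
anyᶠ-true⁺ p Fin.zero pi≡true = ∨-trueˡ _ pi≡true
anyᶠ-true⁺ p (Fin.suc i) pi≡true = ∨-trueʳ (p Fin.zero) (anyᶠ-true⁺ (λ i → p (Fin.suc i)) i pi≡true)

anyᶠ-true⁻ : ∀ {n} (p : Fin n → Bool) → anyᶠ p ≡ true → ∃ λ i → p i ≡ true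
anyᶠ-true⁻ {zero} p ()
anyᶠ-true⁻ {suc n} p any≡true with ∨-true {p Fin.zero} any≡true
... | inj₁ p0≡true = Fin.zero , p0≡true
... | inj₂ rest≡true with anyᶠ-true⁻ (λ i → p (Fin.suc i)) rest≡true
... | i , pi≡true = Fin.suc i , pi≡true

anyᶠ-cong : ∀ {n} {p q : Fin n → Bool} → (∀ i → p i ≡ q i) → anyᶠ p ≡ anyᶠ q
anyᶠ-cong {zero} p≗q = refl
anyᶠ-cong {suc n} p≗q = cong₂ _∨_ (p≗q Fin.zero) (anyᶠ-cong (λ i → p≗q (Fin.suc i)))

-- The set reached within j steps grows strictly until it is stable, so n steps decide reachability.
module BreadthFirst {n} (G : Graph n) (v : Fin n) where

  reachedWithin : ℕ → Fin n → Bool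
  reachedWithin zero w = ⌊ v FinP.≟ w ⌋
  reachedWithin (suc j) w = reachedWithin j w ∨ anyᶠ (λ u → reachedWithin j u ∧ adj G u w)

  reachedWithin-sound : ∀ j w → reachedWithin j w ≡ true → Reach G v w
  reachedWithin-sound zero w reached with v FinP.≟ w
  reachedWithin-sound zero w reached | yes refl = ε
  reachedWithin-sound zero w () | no _
  reachedWithin-sound (suc j) w reached with ∨-true {reachedWithin j w} reached
  ... | inj₁ earlier = reachedWithin-sound j w earlier
  ... | inj₂ viaEdge with anyᶠ-true⁻ (λ u → reachedWithin j u ∧ adj G u w) viaEdge
  ... | u , u-reached∧edge with ∧-true {reachedWithin j u} u-reached∧edge
  ... | u-reached , edge = reachedWithin-sound j u u-reached ◅◅ (edge ◅ ε)

  reachedWithin-+ : ∀ t j w → reachedWithin j w ≡ true → reachedWithin (t + j) w ≡ true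
  reachedWithin-+ zero j w reached = reached
  reachedWithin-+ (suc t) j w reached = ∨-trueˡ _ (reachedWithin-+ t j w reached)

  reachedWithin-walk : ∀ {u w} → Reach G u w → ∀ j → reachedWithin j u ≡ true →
    ∃ λ l → reachedWithin l w ≡ true
  reachedWithin-walk ε j reached = j , reached
  reachedWithin-walk {u} (_◅_ {j = u′} edge walk) j reached =
    reachedWithin-walk walk (suc j)
      (∨-trueʳ (reachedWithin j u′)
        (anyᶠ-true⁺ (λ z → reachedWithin j z ∧ adj G z u′) u (cong₂ _∧_ reached edge)))

  Stable : ℕ → Set
  Stable j = ∀ w → reachedWithin (suc j) w ≡ reachedWithin j w

  stable-+ : ∀ {j} → Stable j → ∀ t w → reachedWithin (t + j) w ≡ reachedWithin j w
  stable-+ stable zero w = refl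
  stable-+ stable (suc t) w = trans
    (cong₂ _∨_ (stable-+ stable t w)
               (anyᶠ-cong (λ u → cong (_∧ adj G u w) (stable-+ stable t u))))
    (stable w)

  stable? : ∀ j → Dec (Stable j)
  stable? j = FinP.all? (λ w → reachedWithin (suc j) w Bool.≟ reachedWithin j w)

  stable-or-grown : ∀ j → (∃ λ j′ → j′ ≤ j × Stable j′) ⊎ (j < countᶠ (reachedWithin j))
  stable-or-grown zero = inj₂ (countᶠ-pos (reachedWithin zero) v (isYes-true (v FinP.≟ v) refl))
  stable-or-grown (suc j) with stable-or-grown j
  ... | inj₁ (j′ , j′≤j , stable) = inj₁ (j′ , ℕP.m≤n⇒m≤1+n j′≤j , stable)
  ... | inj₂ j<count with stable? j
  ... | yes stable = inj₁ (j , ℕP.n≤1+n j , stable)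
  ... | no ¬stable with FinP.¬∀⟶∃¬ n _ (λ w → reachedWithin (suc j) w Bool.≟ reachedWithin j w) ¬stable
  ... | w , changed with strictly-grew (∨-trueˡ _) changed
  ... | old , new = inj₂ (ℕP.<-≤-trans (s≤s j<count) (countᶠ-mono-< (λ u → ∨-trueˡ _) w old new))

  stabilises : ∃ λ j → j ≤ n × Stable j
  stabilises with stable-or-grown n
  ... | inj₁ stable = stable
  ... | inj₂ n<count = ⊥-elim (ℕP.<-irrefl refl (ℕP.<-≤-trans n<count (countᶠ≤n (reachedWithin n))))

  reachedWithin-complete : ∀ w → Reach G v w → reachedWithin n w ≡ true
  reachedWithin-complete w walk with reachedWithin-walk walk zero (isYes-true (v FinP.≟ v) refl) | stabilises
  ... | l , reached | j , j≤n , stable =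
    subst (λ z → reachedWithin z w ≡ true) (ℕP.m∸n+n≡m j≤n)
      (reachedWithin-+ (n ∸ j) j w
        (trans (sym (stable-+ stable l w))
               (subst (λ z → reachedWithin z w ≡ true) (ℕP.+-comm j l) (reachedWithin-+ j l w reached))))

reach? : ∀ {n} (G : Graph n) v w → Dec (Reach G v w)
reach? {n} G v w with BreadthFirst.reachedWithin G v n w in reached
... | true = yes (BreadthFirst.reachedWithin-sound G v n w reached)
... | false = no λ walk → false≢true (trans (sym reached) (BreadthFirst.reachedWithin-complete G v w walk))
  where
  false≢true : false ≢ true
  false≢true ()

record Enumeration {n} (P : Fin n → Set) : Set where
  field
    card         : ℕ
    at           : Fin card → Fin n
    at-injective : Injective _≡_ _≡_ at
    at-sound     : ∀ a → P (at a)
    at-complete  : ∀ w → P w → ∃ λ a → at a ≡ w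
    at-monotone  : ∀ a b → toℕ a ≤ toℕ b → toℕ (at a) ≤ toℕ (at b)

enumerate : ∀ {n} (P : Fin n → Set) → (∀ w → Dec (P w)) → Enumeration P
enumerate {zero} P P? = record
  { card = 0 ; at = λ () ; at-injective = λ {x} → ⊥-elim (FinP.¬Fin0 x)
  ; at-sound = λ () ; at-complete = λ () ; at-monotone = λ () }
enumerate {suc n} P P? with P? Fin.zero | enumerate (λ w → P (Fin.suc w)) (λ w → P? (Fin.suc w))
... | no ¬P0 | rest = record
  { card = card
  ; at = λ a → Fin.suc (at a)
  ; at-injective = λ eq → at-injective (FinP.suc-injective eq)
  ; at-sound = at-sound
  ; at-complete = onto
  ; at-monotone = λ a b a≤b → s≤s (at-monotone a b a≤b) }
  where
  open Enumeration rest
  onto : ∀ w → P w → ∃ λ a → Fin.suc (at a) ≡ w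
  onto Fin.zero P0 = ⊥-elim (¬P0 P0)
  onto (Fin.suc w) Pw = let a , eq = at-complete w Pw in a , cong Fin.suc eq
... | yes P0 | rest = record
  { card = suc card ; at = at′ ; at-injective = injective ; at-sound = sound
  ; at-complete = onto ; at-monotone = monotone }
  where
  open Enumeration rest
  at′ : Fin (suc card) → Fin (suc n)
  at′ Fin.zero = Fin.zero
  at′ (Fin.suc a) = Fin.suc (at a)
  injective : Injective _≡_ _≡_ at′
  injective {Fin.zero} {Fin.zero} _ = refl
  injective {Fin.suc x} {Fin.suc y} eq = cong Fin.suc (at-injective (FinP.suc-injective eq))
  sound : ∀ a → P (at′ a)
  sound Fin.zero = P0
  sound (Fin.suc a) = at-sound a
  onto : ∀ w → P w → ∃ λ a → at′ a ≡ w
  onto Fin.zero _ = Fin.zero , refl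
  onto (Fin.suc w) Pw = let a , eq = at-complete w Pw in Fin.suc a , cong Fin.suc eq
  monotone : ∀ a b → toℕ a ≤ toℕ b → toℕ (at′ a) ≤ toℕ (at′ b)
  monotone Fin.zero b _ = z≤n
  monotone (Fin.suc a) (Fin.suc b) (s≤s a≤b) = s≤s (at-monotone a b a≤b)

ComponentsAtMost : ∀ {n} → ℕ → Graph n → Set
ComponentsAtMost {n} k G =
  ∀ v (S : Fin (suc k) → Fin n) → Injective _≡_ _≡_ S → (∀ a → Reach G v (S a)) → ⊥

module _ {n} (G : Graph n) where

  Leader-unique : ∀ {x y} → Leader G x → Leader G y → Reach G x y → x ≡ y
  Leader-unique x-leads y-leads x↝y =
    FinP.toℕ-injective (ℕP.≤-antisym (x-leads _ x↝y) (y-leads _ (Reach-sym G x↝y)))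

  CompIso-reach : ∀ {m} {H : Graph m} {x y} → CompIso G x H → Reach G x y → CompIso G y H
  CompIso-reach (f , f-inj , f-reach , f-onto , f-adj) x↝y =
    f , f-inj , (λ a → Reach-sym G x↝y ◅◅ f-reach a) , (λ w y↝w → f-onto w (x↝y ◅◅ y↝w)) , f-adj

  CompIso-unique : ∀ {m₁ m₂} {H₁ : Graph m₁} {H₂ : Graph m₂} {x} →
    CompIso G x H₁ → CompIso G x H₂ → Iso H₁ H₂
  CompIso-unique {m₁} {m₂} {H₁} {H₂} (f₁ , f₁-inj , f₁-reach , f₁-onto , f₁-adj)
                              (f₂ , f₂-inj , f₂-reach , f₂-onto , f₂-adj) =
    mk↔ₛ′ to from to∘from from∘to , preserves
    where
    to : Fin m₁ → Fin m₂
    to a = proj₁ (f₂-onto (f₁ a) (f₁-reach a))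
    from : Fin m₂ → Fin m₁
    from b = proj₁ (f₁-onto (f₂ b) (f₂-reach b))
    f₂∘to : ∀ a → f₂ (to a) ≡ f₁ a
    f₂∘to a = proj₂ (f₂-onto (f₁ a) (f₁-reach a))
    f₁∘from : ∀ b → f₁ (from b) ≡ f₂ b
    f₁∘from b = proj₂ (f₁-onto (f₂ b) (f₂-reach b))
    to∘from : ∀ b → to (from b) ≡ b
    to∘from b = f₂-inj (trans (f₂∘to (from b)) (f₁∘from b))
    from∘to : ∀ a → from (to a) ≡ a
    from∘to a = f₁-inj (trans (f₁∘from (to a)) (f₂∘to a))
    preserves : ∀ i j → adj H₁ i j ≡ adj H₂ (to i) (to j)
    preserves i j = trans (f₁-adj i j)
      (trans (cong₂ (adj G) (sym (f₂∘to i)) (sym (f₂∘to j))) (sym (f₂-adj (to i) (to j))))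

-- Enumerating the component in increasing order makes its first vertex the leader.
module Component {n} (G : Graph n) (v : Fin n) where

  open Enumeration (enumerate (Reach G v) (reach? G v)) public

  graph : Graph card
  graph = record
    { adj = λ a b → adj G (at a) (at b)
    ; sym = λ a b → adj-sym G (at a) (at b)
    ; irrefl = λ a → irrefl G (at a) }

  first : Fin card
  first = Fin.fromℕ< (ℕP.≤-<-trans z≤n (FinP.toℕ<n (proj₁ (at-complete v ε))))

  leader : Fin n
  leader = at first

  v↝leader : Reach G v leader
  v↝leader = at-sound first

  leader-isLeader : Leader G leader
  leader-isLeader w leader↝w with at-complete w (v↝leader ◅◅ leader↝w)
  ... | b , refl = at-monotone first b (subst (_≤ toℕ b) (sym (FinP.toℕ-fromℕ< _)) z≤n)

  walk-in-graph : ∀ {x y} → Reach G x y → ∀ a → at a ≡ x → ∃ λ b → at b ≡ y × Reach graph a b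
  walk-in-graph ε a refl = a , refl , ε
  walk-in-graph (_◅_ {j = x′} edge walk) a refl with at-complete x′ (at-sound a ◅◅ (edge ◅ ε))
  ... | a′ , refl with walk-in-graph walk a′ refl
  ... | b , refl , walk′ = b , refl , (edge ◅ walk′)

  connected : ConnectedGraph graph
  connected = ℕP.≤-<-trans z≤n (FinP.toℕ<n first) , joined
    where
    joined : ∀ a b → Reach graph a b
    joined a b with walk-in-graph (Reach-sym G (at-sound a) ◅◅ at-sound b) a refl
    ... | b′ , atb′≡atb , walk = subst (Reach graph a) (at-injective atb′≡atb) walk

  card≤ : ∀ {k} → ComponentsAtMost k G → card ≤ k
  card≤ {k} bounded with card ℕP.≤? k
  ... | yes card≤k = card≤k
  ... | no card≰k = ⊥-elim (bounded v (λ x → at (Fin.inject≤ x k<card))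
          (λ eq → FinP.inject≤-injective k<card k<card _ _ (at-injective eq)) (λ _ → at-sound _))
    where k<card = ℕP.≰⇒> card≰k

  classify : ∀ {k} (R : ClassReps k) → card ≤ k → Σ (Fin (r R)) λ i → CompIso G leader (rep R i)
  classify R card≤k with complete R card graph card≤k connected
  ... | i , π , π-adj = i , f , f-inj , f-reach , f-onto , f-adj
    where
    f : Fin (size R i) → Fin n
    f a = at (π ⟨$⟩ˡ a)
    f-inj : Injective _≡_ _≡_ f
    f-inj eq = ⟨$⟩ˡ-injective π (at-injective eq)
    f-reach : ∀ a → Reach G leader (f a)
    f-reach a = Reach-sym G v↝leader ◅◅ at-sound _
    f-onto : ∀ w → Reach G leader w → ∃ λ a → f a ≡ w
    f-onto w leader↝w with at-complete w (v↝leader ◅◅ leader↝w)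
    ... | b , refl = π ⟨$⟩ʳ b , cong at (Perm.inverseˡ π)
    f-adj : ∀ a b → adj (rep R i) a b ≡ adj G (f a) (f b)
    f-adj a b = sym (trans (π-adj (π ⟨$⟩ˡ a) (π ⟨$⟩ˡ b))
                           (cong₂ (adj (rep R i)) (Perm.inverseʳ π) (Perm.inverseʳ π)))

Iso-sym : ∀ {m n} {X : Graph m} {Y : Graph n} → Iso X Y → Iso Y X
Iso-sym {Y = Y} (π , π-adj) = Perm.flip π , λ i j →
  sym (trans (π-adj (π ⟨$⟩ˡ i) (π ⟨$⟩ˡ j)) (cong₂ (adj Y) (Perm.inverseʳ π) (Perm.inverseʳ π)))

module Transport {n} (X Y : Graph n) (iso : Iso X Y) where

  π : Permutation n n
  π = proj₁ iso

  Reach-map : ∀ {u w} → Reach X u w → Reach Y (π ⟨$⟩ʳ u) (π ⟨$⟩ʳ w)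
  Reach-map = Star.gmap (π ⟨$⟩ʳ_) (λ {u} {w} edge → trans (sym (proj₂ iso u w)) edge)

  Reach-map⁻ : ∀ {a b} → Reach Y a b → Reach X (π ⟨$⟩ˡ a) (π ⟨$⟩ˡ b)
  Reach-map⁻ = Star.gmap (π ⟨$⟩ˡ_) (λ {a} {b} edge →
    trans (proj₂ iso _ _) (trans (cong₂ (adj Y) (Perm.inverseʳ π) (Perm.inverseʳ π)) edge))

  CompIso-map : ∀ {m} {H : Graph m} {v} → CompIso X v H → CompIso Y (π ⟨$⟩ʳ v) H
  CompIso-map {v = v} (f , f-inj , f-reach , f-onto , f-adj) =
    (λ a → π ⟨$⟩ʳ f a) , (λ eq → f-inj (⟨$⟩ʳ-injective π eq)) , (λ a → Reach-map (f-reach a)) ,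
    onto , (λ a b → trans (f-adj a b) (proj₂ iso (f a) (f b)))
    where
    onto : ∀ w → Reach Y (π ⟨$⟩ʳ v) w → ∃ λ a → π ⟨$⟩ʳ f a ≡ w
    onto w πv↝w with f-onto (π ⟨$⟩ˡ w)
      (subst (λ z → Reach X z (π ⟨$⟩ˡ w)) (Perm.inverseˡ π) (Reach-map⁻ πv↝w))
    ... | a , fa≡π⁻¹w = a , trans (cong (π ⟨$⟩ʳ_) fa≡π⁻¹w) (Perm.inverseʳ π)

  CompCount-≤ : ∀ {m} {H : Graph m} {a b} → CompCount X H a → CompCount Y H b → a ≤ b
  CompCount-≤ {H = H} {a} {b} (fX , fX-inj , fX-leads , _) (fY , _ , _ , fY-onto) = FinP.injective⇒≤ g-inj
    where
    leaderOf : Fin a → Fin n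
    leaderOf c = Component.leader Y (π ⟨$⟩ʳ fX c)
    leads : ∀ c → Leader Y (leaderOf c) × CompIso Y (leaderOf c) H
    leads c = Component.leader-isLeader Y _ ,
      CompIso-reach Y {H = H} (CompIso-map {H = H} (proj₂ (fX-leads c))) (Component.v↝leader Y _)
    g : Fin a → Fin b
    g c = proj₁ (fY-onto (leaderOf c) (leads c))
    g-inj : Injective _≡_ _≡_ g
    g-inj {c} {c′} eq = fX-inj (Leader-unique X (proj₁ (fX-leads c)) (proj₁ (fX-leads c′))
      (subst₂ (Reach X) (Perm.inverseˡ π) (Perm.inverseˡ π) (Reach-map⁻ πc↝πc′)))
      where
      same-leader : leaderOf c ≡ leaderOf c′
      same-leader = trans (sym (proj₂ (fY-onto _ (leads c)))) (trans (cong fY eq) (proj₂ (fY-onto _ (leads c′))))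
      πc↝πc′ : Reach Y (π ⟨$⟩ʳ fX c) (π ⟨$⟩ʳ fX c′)
      πc↝πc′ = Component.v↝leader Y _ ◅◅ subst (Reach Y (leaderOf c)) same-leader ε
                 ◅◅ Reach-sym Y (Component.v↝leader Y _)

Iso⇒SameCnt : ∀ {n} {X Y : Graph n} k → Iso X Y → SameCnt k X Y
Iso⇒SameCnt {X = X} {Y} k iso m H _ _ a b countX countY = ℕP.≤-antisym
  (Transport.CompCount-≤ X Y iso {H = H} countX countY)
  (Transport.CompCount-≤ Y X (Iso-sym {X = X} {Y} iso) {H = H} countY countX)

ComponentsAtMost-iso : ∀ {n k} (X Y : Graph n) → Iso Y X → ComponentsAtMost k X → ComponentsAtMost k Y
ComponentsAtMost-iso X Y iso boundedX v S S-inj v↝S =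
  boundedX (π ⟨$⟩ʳ v) (λ a → π ⟨$⟩ʳ S a) (λ eq → S-inj (⟨$⟩ʳ-injective π eq)) (λ a → Reach-map (v↝S a))
  where open Transport Y X iso

relabel : ∀ {n} → Permutation n n → Graph n → Graph n
relabel π X = record
  { adj = λ i j → adj X (π ⟨$⟩ˡ i) (π ⟨$⟩ˡ j)
  ; sym = λ i j → adj-sym X _ _
  ; irrefl = λ i → irrefl X _ }

relabel-iso : ∀ {n} (π : Permutation n n) (X : Graph n) → Iso X (relabel π X)
relabel-iso π X = π , λ u w → sym (cong₂ (adj X) (Perm.inverseˡ π) (Perm.inverseˡ π))

deletions : ∀ {n} → Graph n → Graph n → Fin n → Fin n → Bool
deletions X Y i j = adj X i j ∧ not (adj Y i j)

deletions-sym : ∀ {n} (X Y : Graph n) i j → deletions X Y i j ≡ deletions X Y j i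
deletions-sym X Y i j = cong₂ (λ a b → a ∧ not b) (adj-sym X i j) (adj-sym Y i j)

deletions-irrefl : ∀ {n} (X Y : Graph n) i → deletions X Y i i ≡ false
deletions-irrefl X Y i rewrite irrefl X i = refl

IsPartition-iso : ∀ {n δ d k} {G H P : Graph n} (iso : Iso G H) → IsPartition δ d k G P →
  IsPartition δ d k H (relabel (proj₁ iso) P)
IsPartition-iso {n} {δ} {d} {G = G} {H} {P} (π , π-adj) (P⊆G , few-deletions , bounded) =
  P′⊆H , subst (λ c → toℚ c ℚ.≤ δ ℚ.* toℚ (d * n)) same-deletions few-deletions ,
  ComponentsAtMost-iso P P′ (Iso-sym {X = P} {P′} (relabel-iso π P)) bounded
  where
  P′ : Graph n
  P′ = relabel π P
  P′⊆H : ∀ i j → E P′ i j → E H i j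
  P′⊆H i j edge = subst₂ (E H) (Perm.inverseʳ π) (Perm.inverseʳ π) (trans (sym (π-adj _ _)) (P⊆G _ _ edge))
  same-deletions : countPairs (deletions G P) ≡ countPairs (deletions H P′)
  same-deletions = trans
    (countPairs-cong λ u w → cong₂ (λ a b → a ∧ not b) (π-adj u w)
                                   (sym (cong₂ (adj P) (Perm.inverseˡ π) (Perm.inverseˡ π))))
    (countPairs-permute π (deletions H P′) (deletions-sym H P′) (deletions-irrefl H P′))

mismatch : ∀ {n} → Graph n → Graph n → Permutation n n → Fin n → Fin n → Bool
mismatch X Y π i j = adj X i j xor adj Y (π ⟨$⟩ʳ i) (π ⟨$⟩ʳ j)

countOrdered-mismatch : ∀ {n} (X Y : Graph n) π → countOrdered (mismatch X Y π) ≡ 2 * diffUnder X Y π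
countOrdered-mismatch X Y π = countOrdered≡2*countPairs (mismatch X Y π)
  (λ i j → cong₂ _xor_ (adj-sym X i j) (adj-sym Y _ _))
  (λ i → cong₂ _xor_ (irrefl X i) (irrefl Y _))

𝟙-xor : ∀ x y → 𝟙 (x xor y) ≤ 𝟙 x + 𝟙 y
𝟙-xor true true = z≤n
𝟙-xor true false = ℕP.≤-refl
𝟙-xor false y = ℕP.≤-refl

𝟙-xor-triangle : ∀ x y z → 𝟙 (x xor z) ≤ 𝟙 (x xor y) + 𝟙 (y xor z)
𝟙-xor-triangle true true true = z≤n
𝟙-xor-triangle true true false = ℕP.≤-refl
𝟙-xor-triangle true false true = z≤n
𝟙-xor-triangle true false false = s≤s z≤n
𝟙-xor-triangle false true true = s≤s z≤n
𝟙-xor-triangle false true false = z≤n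
𝟙-xor-triangle false false true = ℕP.≤-refl
𝟙-xor-triangle false false false = z≤n

countOrdered-xor-triangle : ∀ {n} (x y z : Fin n → Fin n → Bool) →
  countOrdered (λ i j → x i j xor z i j)
    ≤ countOrdered (λ i j → x i j xor y i j) + countOrdered (λ i j → y i j xor z i j)
countOrdered-xor-triangle x y z = countOrdered-subadditive (λ i j → 𝟙-xor-triangle (x i j) (y i j) (z i j))

diffUnder-triangle : ∀ {n} (G P Q F : Graph n) (π : Permutation n n) →
  diffUnder G F π ≤ diffUnder G P Perm.id + diffUnder P Q π + diffUnder F Q Perm.id
diffUnder-triangle {n} G P Q F π = ℕP.*-cancelˡ-≤ 2 (begin
  2 * diffUnder G F π                  ≡⟨ countOrdered-mismatch G F π ⟨
  countOrdered (mismatch G F π)        ≤⟨ countOrdered-xor-triangle (adj G) (adj P) Fπ ⟩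
  cGP + countOrdered (mismatch P F π)  ≤⟨ ℕP.+-monoʳ-≤ cGP (countOrdered-xor-triangle (adj P) Qπ Fπ) ⟩
  cGP + (cPQ + cQF)                    ≡⟨ ℕP.+-assoc cGP cPQ cQF ⟨
  cGP + cPQ + cQF                      ≡⟨ cong₂ _+_ (cong₂ _+_ (countOrdered-mismatch G P Perm.id)
                                                              (countOrdered-mismatch P Q π)) F-vs-Q ⟩
  2 * A + 2 * Y + 2 * B                ≡⟨ cong (_+ 2 * B) (ℕP.*-distribˡ-+ 2 A Y) ⟨
  2 * (A + Y) + 2 * B                  ≡⟨ ℕP.*-distribˡ-+ 2 (A + Y) B ⟨
  2 * (A + Y + B)                      ∎)
  where
  open ℕP.≤-Reasoning
  Qπ Fπ : Fin n → Fin n → Bool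
  Qπ i j = adj Q (π ⟨$⟩ʳ i) (π ⟨$⟩ʳ j)
  Fπ i j = adj F (π ⟨$⟩ʳ i) (π ⟨$⟩ʳ j)
  A Y B : ℕ
  A = diffUnder G P Perm.id
  Y = diffUnder P Q π
  B = diffUnder F Q Perm.id
  cGP cPQ cQF : ℕ
  cGP = countOrdered (mismatch G P Perm.id)
  cPQ = countOrdered (mismatch P Q π)
  cQF = countOrdered (λ i j → Qπ i j xor Fπ i j)
  F-vs-Q : cQF ≡ 2 * B
  F-vs-Q = begin-equality
    cQF                                             ≡⟨ countOrdered-permute π (λ u w → adj Q u w xor adj F u w) ⟩
    countOrdered (λ u w → adj Q u w xor adj F u w)  ≡⟨ countOrdered-cong (λ u w → xor-comm (adj Q u w) (adj F u w)) ⟩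
    countOrdered (mismatch F Q Perm.id)             ≡⟨ countOrdered-mismatch F Q Perm.id ⟩
    2 * B                                           ∎

xor-⊆ : ∀ x y → (y ≡ true → x ≡ true) → (x xor y) ≡ (x ∧ not y)
xor-⊆ x true y⇒x rewrite y⇒x refl = refl
xor-⊆ x false _ = trans (xor-identityʳ x) (sym (∧-identityʳ x))

diffUnder-id-⊆ : ∀ {n} (X Y : Graph n) → (∀ i j → E Y i j → E X i j) →
  diffUnder X Y Perm.id ≡ countPairs (deletions X Y)
diffUnder-id-⊆ X Y Y⊆X = countPairs-cong (λ i j → xor-⊆ (adj X i j) (adj Y i j) (Y⊆X i j))

xor-true-elim : ∀ {x y} {C : Set} → (x xor y) ≡ true → (x ≡ true → C) → (y ≡ true → C) → C
xor-true-elim {true} _ onX onY = onX refl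
xor-true-elim {false} y≡true onX onY = onY y≡true

Σ-decode : ∀ {r} (H : Fin r → ℕ) → Fin (sumᶠ H) → Σ (Fin r) (λ i → Fin (H i))
Σ-decode {zero} H x = ⊥-elim (FinP.¬Fin0 x)
Σ-decode {suc r} H x with Fin.splitAt (H Fin.zero) x
... | inj₁ y = Fin.zero , y
... | inj₂ z = let i , y = Σ-decode (λ i → H (Fin.suc i)) z in Fin.suc i , y

Σ-encode : ∀ {r} (H : Fin r → ℕ) → Σ (Fin r) (λ i → Fin (H i)) → Fin (sumᶠ H)
Σ-encode {suc r} H (Fin.zero , y) = y Fin.↑ˡ sumᶠ (λ i → H (Fin.suc i))
Σ-encode {suc r} H (Fin.suc i , y) = H Fin.zero Fin.↑ʳ Σ-encode (λ i → H (Fin.suc i)) (i , y)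

Σ-decode-encode : ∀ {r} (H : Fin r → ℕ) x → Σ-decode H (Σ-encode H x) ≡ x
Σ-decode-encode {suc r} H (Fin.zero , y)
  rewrite FinP.splitAt-↑ˡ (H Fin.zero) y (sumᶠ (λ i → H (Fin.suc i))) = refl
Σ-decode-encode {suc r} H (Fin.suc i , y)
  rewrite FinP.splitAt-↑ʳ (H Fin.zero) (sumᶠ (λ i → H (Fin.suc i))) (Σ-encode (λ i → H (Fin.suc i)) (i , y))
        | Σ-decode-encode (λ i → H (Fin.suc i)) (i , y) = refl

Σ-encode-decode : ∀ {r} (H : Fin r → ℕ) x → Σ-encode H (Σ-decode H x) ≡ x
Σ-encode-decode {zero} H x = ⊥-elim (FinP.¬Fin0 x)
Σ-encode-decode {suc r} H x with Fin.splitAt (H Fin.zero) x in split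
... | inj₁ y = FinP.splitAt⁻¹-↑ˡ split
... | inj₂ z = trans (cong (H Fin.zero Fin.↑ʳ_) (Σ-encode-decode (λ i → H (Fin.suc i)) z)) (FinP.splitAt⁻¹-↑ʳ split)

-- A slot (i , c , a) stands for vertex a of the c-th copy of the i-th component type.
Slot : ∀ {r} (h s : Fin r → ℕ) → Set
Slot {r} h s = Σ (Fin r) λ i → Fin (h i) × Fin (s i)

nSlots : ∀ {r} (h s : Fin r → ℕ) → ℕ
nSlots h s = sumᶠ (λ i → h i * s i)

slot-decode : ∀ {r} (h s : Fin r → ℕ) → Fin (nSlots h s) → Slot h s
slot-decode h s x = let i , y = Σ-decode (λ i → h i * s i) x in i , Fin.remQuot (s i) y

slot-encode : ∀ {r} (h s : Fin r → ℕ) → Slot h s → Fin (nSlots h s)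
slot-encode h s (i , c , a) = Σ-encode (λ i → h i * s i) (i , Fin.combine c a)

slot-decode-encode : ∀ {r} (h s : Fin r → ℕ) x → slot-decode h s (slot-encode h s x) ≡ x
slot-decode-encode h s (i , c , a)
  rewrite Σ-decode-encode (λ i → h i * s i) (i , Fin.combine c a) | FinP.remQuot-combine {k = s i} c a = refl

slot-encode-decode : ∀ {r} (h s : Fin r → ℕ) x → slot-encode h s (slot-decode h s x) ≡ x
slot-encode-decode h s x with Σ-decode (λ i → h i * s i) x in decoded
... | i , y = trans (cong (λ z → Σ-encode (λ i → h i * s i) (i , z)) (FinP.combine-remQuot {h i} (s i) y))
                    (trans (cong (Σ-encode (λ i → h i * s i)) (sym decoded)) (Σ-encode-decode (λ i → h i * s i) x))

slot-decode-injective : ∀ {r} (h s : Fin r → ℕ) → Injective _≡_ _≡_ (slot-decode h s)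
slot-decode-injective h s {x} {y} eq =
  trans (sym (slot-encode-decode h s x)) (trans (cong (slot-encode h s) eq) (slot-encode-decode h s y))

slot-encode-injective : ∀ {r} (h s : Fin r → ℕ) → Injective _≡_ _≡_ (slot-encode h s)
slot-encode-injective h s {x} {y} eq =
  trans (sym (slot-decode-encode h s x)) (trans (cong (slot-decode h s) eq) (slot-decode-encode h s y))

nSlots≤ : ∀ {r n} (h s : Fin r → ℕ) (f : Slot h s → Fin n) → Injective _≡_ _≡_ f → nSlots h s ≤ n
nSlots≤ h s f f-inj = FinP.injective⇒≤ {f = f ∘ slot-decode h s} (slot-decode-injective h s ∘ f-inj)

≤nSlots : ∀ {r n} (h s : Fin r → ℕ) (g : Fin n → Slot h s) → Injective _≡_ _≡_ g → n ≤ nSlots h s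
≤nSlots h s g g-inj = FinP.injective⇒≤ {f = slot-encode h s ∘ g} (g-inj ∘ slot-encode-injective h s)

m+n≡2*m⊓n+∣m-n∣ : ∀ m n → m + n ≡ 2 * (m ⊓ n) + ∣ m - n ∣
m+n≡2*m⊓n+∣m-n∣ zero n = refl
m+n≡2*m⊓n+∣m-n∣ (suc m) zero = cong suc (ℕP.+-identityʳ m)
m+n≡2*m⊓n+∣m-n∣ (suc m) (suc n) = begin
  suc m + suc n                       ≡⟨ cong suc (ℕP.+-suc m n) ⟩
  suc (suc (m + n))                   ≡⟨ cong (λ z → suc (suc z)) (m+n≡2*m⊓n+∣m-n∣ m n) ⟩
  suc (suc (2 * (m ⊓ n) + ∣ m - n ∣))  ≡⟨ cong (λ z → suc z + ∣ m - n ∣) (ℕP.+-suc (m ⊓ n) (m ⊓ n + 0)) ⟨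
  2 * suc (m ⊓ n) + ∣ m - n ∣          ∎
  where open ≡-Reasoning

nSlots-+ : ∀ {r} (a b s : Fin r → ℕ) →
  nSlots a s + nSlots b s ≡ 2 * nSlots (λ i → a i ⊓ b i) s + sumᶠ (λ i → ∣ a i - b i ∣ * s i)
nSlots-+ {r} a b s = begin
  nSlots a s + nSlots b s
    ≡⟨ sumᶠ-+ (λ i → a i * s i) (λ i → b i * s i) ⟨
  sumᶠ (λ i → a i * s i + b i * s i)
    ≡⟨ sumᶠ-cong per-type ⟩
  sumᶠ (λ i → 2 * (m i * s i) + d i * s i)
    ≡⟨ sumᶠ-+ (λ i → 2 * (m i * s i)) (λ i → d i * s i) ⟩
  sumᶠ (λ i → 2 * (m i * s i)) + sumᶠ (λ i → d i * s i)
    ≡⟨ cong (λ z → z + sumᶠ (λ i → d i * s i)) (sumᶠ-*ˡ 2 (λ i → m i * s i)) ⟩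
  2 * nSlots m s + sumᶠ (λ i → d i * s i)
    ∎
  where
  open ≡-Reasoning
  m d : Fin r → ℕ
  m i = a i ⊓ b i
  d i = ∣ a i - b i ∣
  per-type : ∀ i → a i * s i + b i * s i ≡ 2 * (m i * s i) + d i * s i
  per-type i = begin
    a i * s i + b i * s i         ≡⟨ ℕP.*-distribʳ-+ (s i) (a i) (b i) ⟨
    (a i + b i) * s i             ≡⟨ cong (_* s i) (m+n≡2*m⊓n+∣m-n∣ (a i) (b i)) ⟩
    (2 * m i + d i) * s i         ≡⟨ ℕP.*-distribʳ-+ (s i) (2 * m i) (d i) ⟩
    2 * m i * s i + d i * s i     ≡⟨ cong (_+ d i * s i) (ℕP.*-assoc 2 (m i) (s i)) ⟩
    2 * (m i * s i) + d i * s i   ∎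

Σ-≡-injective : ∀ {A : Set} {B : A → Set} {x : A} {u u′ : B x} → _≡_ {A = Σ A B} (x , u) (x , u′) → u ≡ u′
Σ-≡-injective refl = refl

module CompIso-fields {n m} {G : Graph n} {v} {H : Graph m} (iso : CompIso G v H) where

  embed : Fin m → Fin n
  embed = proj₁ iso

  embed-injective : Injective _≡_ _≡_ embed
  embed-injective = proj₁ (proj₂ iso)

  embed-reach : ∀ a → Reach G v (embed a)
  embed-reach = proj₁ (proj₂ (proj₂ iso))

  embed-onto : ∀ w → Reach G v w → ∃ λ a → embed a ≡ w
  embed-onto = proj₁ (proj₂ (proj₂ (proj₂ iso)))

  embed-adj : ∀ a b → adj H a b ≡ adj G (embed a) (embed b)
  embed-adj = proj₂ (proj₂ (proj₂ (proj₂ iso)))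

module Decomposition {n k} (R : ClassReps k) (X : Graph n) (bounded : ComponentsAtMost k X)
  (h : Fin (r R) → ℕ) (counts : ∀ i → CompCount X (rep R i) (h i)) where

  copy : ∀ i → Fin (h i) → Fin n
  copy i = proj₁ (counts i)

  copy-injective : ∀ i → Injective _≡_ _≡_ (copy i)
  copy-injective i = proj₁ (proj₂ (counts i))

  copy-leads : ∀ i c → Leader X (copy i c) × CompIso X (copy i c) (rep R i)
  copy-leads i = proj₁ (proj₂ (proj₂ (counts i)))

  copy-complete : ∀ i w → Leader X w × CompIso X w (rep R i) → ∃ λ c → copy i c ≡ w
  copy-complete i = proj₂ (proj₂ (proj₂ (counts i)))

  module Copy i c = CompIso-fields {G = X} {H = rep R i} (proj₂ (copy-leads i c))

  place : Slot h (size R) → Fin n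
  place (i , c , a) = Copy.embed i c a

  place-onto : ∀ v → ∃ λ x → place x ≡ v
  place-onto v with Component.classify X v R (Component.card≤ X v bounded)
  ... | i , iso with copy-complete i (Component.leader X v) (Component.leader-isLeader X v , iso)
  ... | c , copy≡leader with Copy.embed-onto i c v
        (subst (λ z → Reach X z v) (sym copy≡leader) (Reach-sym X (Component.v↝leader X v)))
  ... | a , embed≡v = (i , c , a) , embed≡v

  same-component : ∀ {i c a i′ c′ a′} → place (i , c , a) ≡ place (i′ , c′ , a′) → copy i c ≡ copy i′ c′
  same-component {i} {c} {a} {i′} {c′} {a′} eq =
    Leader-unique X (proj₁ (copy-leads i c)) (proj₁ (copy-leads i′ c′))
      (Copy.embed-reach i c a ◅◅ subst (Reach X (place (i , c , a))) eq ε ◅◅ Reach-sym X (Copy.embed-reach i′ c′ a′))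

  place-injective : Injective _≡_ _≡_ place
  place-injective {i , c , a} {i′ , c′ , a′} eq
    with distinct R i i′ (CompIso-unique X {H₁ = rep R i} {H₂ = rep R i′} (proj₂ (copy-leads i c))
           (subst (λ z → CompIso X z (rep R i′)) (sym (same-component eq)) (proj₂ (copy-leads i′ c′))))
  ... | refl with copy-injective i (same-component eq)
  ... | refl = cong (λ z → i , c , z) (Copy.embed-injective i c eq)

  n≤nSlots : n ≤ nSlots h (size R)
  n≤nSlots = ≤nSlots h (size R) (λ v → proj₁ (place-onto v)) λ {v} {w} eq →
    trans (sym (proj₂ (place-onto v))) (trans (cong place eq) (proj₂ (place-onto w)))

  neighbour-in-copy : ∀ i c a w → E X (Copy.embed i c a) w → ∃ λ a′ → Copy.embed i c a′ ≡ w
  neighbour-in-copy i c a w edge = Copy.embed-onto i c w (Copy.embed-reach i c a ◅◅ (edge ◅ ε))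

  module First (m : Fin (r R) → ℕ) (m≤h : ∀ i → m i ≤ h i) where

    restrict : Slot m (size R) → Slot h (size R)
    restrict (i , c , a) = i , Fin.inject≤ c (m≤h i) , a

    restrict-injective : Injective _≡_ _≡_ restrict
    restrict-injective {i , c , a} {i′ , c′ , a′} eq with cong proj₁ eq
    ... | refl with Σ-≡-injective eq
    ... | c,a≡c′,a′ = cong₂ (λ x y → i , x , y)
      (FinP.inject≤-injective (m≤h i) (m≤h i) c c′ (cong proj₁ c,a≡c′,a′)) (cong proj₂ c,a≡c′,a′)

    placeFirst : Slot m (size R) → Fin n
    placeFirst = place ∘ restrict

    placeFirst-injective : Injective _≡_ _≡_ placeFirst
    placeFirst-injective eq = restrict-injective (place-injective eq)

module Matching {n k} (d : ℕ) (R : ClassReps k) (P Q : Graph n)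
  (boundedP : ComponentsAtMost k P) (boundedQ : ComponentsAtMost k Q)
  (degP : MaxDeg≤ d P) (degQ : MaxDeg≤ d Q)
  (a b : Fin (r R) → ℕ)
  (countsP : ∀ i → CompCount P (rep R i) (a i)) (countsQ : ∀ i → CompCount Q (rep R i) (b i)) where

  shared : Fin (r R) → ℕ
  shared i = a i ⊓ b i

  module DP = Decomposition R P boundedP a countsP
  module DQ = Decomposition R Q boundedQ b countsQ
  module SP = DP.First shared (λ i → ℕP.m⊓n≤m (a i) (b i))
  module SQ = DQ.First shared (λ i → ℕP.m⊓n≤n (a i) (b i))

  M : ℕ
  M = nSlots shared (size R)

  matchedP matchedQ : Fin M → Fin n
  matchedP = SP.placeFirst ∘ slot-decode shared (size R)
  matchedQ = SQ.placeFirst ∘ slot-decode shared (size R)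

  alignment : Alignment matchedP matchedQ
  alignment = align matchedP matchedQ (slot-decode-injective shared (size R) ∘ SP.placeFirst-injective)
                                      (slot-decode-injective shared (size R) ∘ SQ.placeFirst-injective)

  open Alignment alignment renaming (perm to π)

  π-shared : ∀ x → π ⟨$⟩ʳ SP.placeFirst x ≡ SQ.placeFirst x
  π-shared x = subst (λ z → π ⟨$⟩ʳ SP.placeFirst z ≡ SQ.placeFirst z)
    (slot-decode-encode shared (size R) x) (aligns (slot-encode shared (size R) x))

  differs : Fin n → Fin n → Bool
  differs = mismatch P Q π

  agree-within-copy : ∀ i c x y → differs (SP.placeFirst (i , c , x)) (SP.placeFirst (i , c , y)) ≡ false
  agree-within-copy i c x y = begin
    adj P u w xor adj Q (π ⟨$⟩ʳ u) (π ⟨$⟩ʳ w)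
      ≡⟨ cong₂ (λ u′ w′ → adj P u w xor adj Q u′ w′) (π-shared (i , c , x)) (π-shared (i , c , y)) ⟩
    adj P u w xor adj Q u′ w′
      ≡⟨ cong₂ _xor_ (DP.Copy.embed-adj i cP x y) (DQ.Copy.embed-adj i cQ x y) ⟨
    adj (rep R i) x y xor adj (rep R i) x y
      ≡⟨ xor-same (adj (rep R i) x y) ⟩
    false
      ∎
    where
    open ≡-Reasoning
    cP : Fin (a i)
    cP = Fin.inject≤ c (ℕP.m⊓n≤m (a i) (b i))
    cQ : Fin (b i)
    cQ = Fin.inject≤ c (ℕP.m⊓n≤n (a i) (b i))
    u w u′ w′ : Fin n
    u = DP.Copy.embed i cP x
    w = DP.Copy.embed i cP y
    u′ = DQ.Copy.embed i cQ x
    w′ = DQ.Copy.embed i cQ y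

  differences-stay-in-copy : ∀ i c x w → differs (SP.placeFirst (i , c , x)) w ≡ true →
    ∃ λ y → SP.placeFirst (i , c , y) ≡ w
  differences-stay-in-copy i c x w different = xor-true-elim {adj P (SP.placeFirst (i , c , x)) w} different
    (DP.neighbour-in-copy i (Fin.inject≤ c (ℕP.m⊓n≤m (a i) (b i))) x w)
    λ edgeQ →
      let y , Q-copy≡πw = DQ.neighbour-in-copy i (Fin.inject≤ c (ℕP.m⊓n≤n (a i) (b i))) x (π ⟨$⟩ʳ w)
                            (subst (λ u → E Q u (π ⟨$⟩ʳ w)) (π-shared (i , c , x)) edgeQ)
      in y , ⟨$⟩ʳ-injective π (trans (π-shared (i , c , y)) Q-copy≡πw)

  matched-row-agrees : ∀ x w → differs (SP.placeFirst x) w ≡ false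
  matched-row-agrees (i , c , x) w = ¬-not λ different →
    let y , placed≡w = differences-stay-in-copy i c x w different
    in true≢false (trans (sym different)
         (subst (λ z → differs (SP.placeFirst (i , c , x)) z ≡ false) placed≡w (agree-within-copy i c x y)))
    where
    true≢false : true ≢ false
    true≢false ()

  row≤2d : ∀ u → countᶠ (differs u) ≤ d + d
  row≤2d u = begin
    countᶠ (differs u)
      ≤⟨ sumᶠ-mono-≤ (λ w → 𝟙-xor (adj P u w) (adj Q πu (π ⟨$⟩ʳ w))) ⟩
    sumᶠ (λ w → 𝟙 (adj P u w) + 𝟙 (adj Q πu (π ⟨$⟩ʳ w)))
      ≡⟨ sumᶠ-+ (λ w → 𝟙 (adj P u w)) (λ w → 𝟙 (adj Q πu (π ⟨$⟩ʳ w))) ⟩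
    degree P u + countᶠ (λ w → adj Q πu (π ⟨$⟩ʳ w))
      ≡⟨ cong (λ z → degree P u + z) (sumᶠ-permute π (λ w → 𝟙 (adj Q πu w))) ⟩
    degree P u + degree Q πu
      ≤⟨ ℕP.+-mono-≤ (degP u) (degQ πu) ⟩
    d + d
      ∎
    where
    open ℕP.≤-Reasoning
    πu : Fin n
    πu = π ⟨$⟩ʳ u

  matched-row-empty : ∀ u → outside u ≡ false → countᶠ (differs u) ≤ 0
  matched-row-empty u inside =
    let x , matched≡u = inside-image u inside
    in subst (countᶠ (differs u) ≤_) (ℕP.*-zeroʳ n) (sumᶠ-≤-* 0 λ w →
         ℕP.≤-reflexive (cong 𝟙 (subst (λ z → differs z w ≡ false) matched≡u
                                       (matched-row-agrees (slot-decode shared (size R) x) w))))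

  row-bound : ∀ u → countᶠ (differs u) ≤ 𝟙 (outside u) * (d + d)
  row-bound u = by-cases (outside u) refl
    where
    by-cases : ∀ o → outside u ≡ o → countᶠ (differs u) ≤ 𝟙 o * (d + d)
    by-cases true _ = subst (countᶠ (differs u) ≤_) (sym (ℕP.*-identityˡ (d + d))) (row≤2d u)
    by-cases false inside = matched-row-empty u inside

  ‖a-b‖₁ : ℕ
  ‖a-b‖₁ = sumᶠ (λ i → ∣ a i - b i ∣)

  unmatched-bound : 2 * (n ∸ M) ≤ ‖a-b‖₁ * k
  unmatched-bound = ℕP.≤-trans (ℕP.+-cancelʳ-≤ (2 * M) (2 * (n ∸ M)) W twice-unmatched+matched) W≤
    where
    W : ℕ
    W = sumᶠ (λ i → ∣ a i - b i ∣ * size R i)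
    M≤n : M ≤ n
    M≤n = nSlots≤ shared (size R) SP.placeFirst SP.placeFirst-injective
    twice-unmatched+matched : 2 * (n ∸ M) + 2 * M ≤ W + 2 * M
    twice-unmatched+matched = begin
      2 * (n ∸ M) + 2 * M                 ≡⟨ ℕP.*-distribˡ-+ 2 (n ∸ M) M ⟨
      2 * (n ∸ M + M)                     ≡⟨ cong (2 *_) (ℕP.m∸n+n≡m M≤n) ⟩
      2 * n                               ≡⟨ cong (λ z → n + z) (ℕP.+-identityʳ n) ⟩
      n + n                               ≤⟨ ℕP.+-mono-≤ DP.n≤nSlots DQ.n≤nSlots ⟩
      nSlots a (size R) + nSlots b (size R) ≡⟨ nSlots-+ a b (size R) ⟩
      2 * M + W                           ≡⟨ ℕP.+-comm (2 * M) W ⟩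
      W + 2 * M                           ∎
      where open ℕP.≤-Reasoning
    W≤ : W ≤ ‖a-b‖₁ * k
    W≤ = ℕP.≤-trans (sumᶠ-mono-≤ (λ i → ℕP.*-monoʳ-≤ ∣ a i - b i ∣ (size≤k R i)))
                    (ℕP.≤-reflexive (sumᶠ-*ʳ k (λ i → ∣ a i - b i ∣)))

  close : 2 * diffUnder P Q π ≤ ‖a-b‖₁ * (k * d)
  close = begin
    2 * diffUnder P Q π                       ≡⟨ countOrdered-mismatch P Q π ⟨
    countOrdered differs                      ≤⟨ sumᶠ-mono-≤ row-bound ⟩
    sumᶠ (λ u → 𝟙 (outside u) * (d + d))       ≡⟨ sumᶠ-*ʳ (d + d) (λ u → 𝟙 (outside u)) ⟩
    countᶠ outside * (d + d)                  ≡⟨ cong (_* (d + d)) count-outside ⟩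
    (n ∸ M) * (d + d)                         ≡⟨ solve 2 (λ x d → x :* (d :+ d) := con 2 :* x :* d) refl (n ∸ M) d ⟩
    2 * (n ∸ M) * d                           ≤⟨ ℕP.*-monoˡ-≤ d unmatched-bound ⟩
    ‖a-b‖₁ * k * d                                ≡⟨ ℕP.*-assoc ‖a-b‖₁ k d ⟩
    ‖a-b‖₁ * (k * d)                              ∎
    where
    open ℕP.≤-Reasoning
    open ℕ-Solver

small-components-align : ∀ {n k} d (R : ClassReps k) (P Q : Graph n) →
  ComponentsAtMost k P → ComponentsAtMost k Q → MaxDeg≤ d P → MaxDeg≤ d Q →
  (a b : Fin (r R) → ℕ) → (∀ i → CompCount P (rep R i) (a i)) → (∀ i → CompCount Q (rep R i) (b i)) →
  ∃ λ π → 2 * diffUnder P Q π ≤ sumᶠ (λ i → ∣ a i - b i ∣) * (k * d)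
small-components-align d R P Q boundedP boundedQ degP degQ a b countsP countsQ = Alignment.perm alignment , close
  where open Matching d R P Q boundedP boundedQ degP degQ a b countsP countsQ

MaxDeg≤-⊆ : ∀ {n d} {X Y : Graph n} → (∀ i j → E Y i j → E X i j) → MaxDeg≤ d X → MaxDeg≤ d Y
MaxDeg≤-⊆ Y⊆X degX u = ℕP.≤-trans (countᶠ-mono-≤ (Y⊆X u)) (degX u)

member⇒same-counts : ∀ {n δ d k} {Π : Property n} {G P : Graph n} → IsPartition δ d k G P → G ∈Π Π →
  ∃ λ F → Π F × ∃ λ F′ → IsPartition δ d k F F′ × SameCnt k P F′
member⇒same-counts {n} {δ} {d} {k} {G = G} {P} partition (H , ΠH , iso) =
  H , ΠH , relabel (proj₁ iso) P , IsPartition-iso {n} {δ} {d} {k} {G} {H} {P} iso partition ,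
  Iso⇒SameCnt {X = P} {relabel (proj₁ iso) P} k (relabel-iso (proj₁ iso) P)

far⇒counts-far : ∀ {n d k} {δ : ℚ} → 0ℚ ℚ.< δ → 0 < d →
  {Π : Property n} → (∀ H → Π H → MaxDeg≤ d H) → {G P : Graph n} → MaxDeg≤ d G → IsPartition δ d k G P →
  Far ((+ 3 / 1) ℚ.* δ) d Π G →
  ∀ F → Π F → ∀ F′ → IsPartition δ d k F F′ → L1DistGreater k P F′ (δ ℚ.* toℚ n) (k * d)
far⇒counts-far {n} {d} {k} {δ} 0<δ 0<d degΠ {G} {P} degG (P⊆G , fewP , boundedP) far
               F ΠF F′ (F′⊆F , fewF′ , boundedF′) R a b countsP countsF′ =
  decidable-stable (δ ℚ.* toℚ n ℚP.<? toℚ T) λ counts-close →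
    2x≤5e⇒x≯3e e {X} {A} {T} {B} 0≤e fewP (T≤e (ℚP.≮⇒≥ counts-close)) fewF′ X+X≤
      (subst (ℚ._< toℚ X) (ℚP.*-assoc (+ 3 / 1) δ (toℚ (d * n))) (far F ΠF π))
  where
  instance
    δ-nonNeg : ℚ.NonNegative δ
    δ-nonNeg = ℚ.nonNegative (ℚP.<⇒≤ 0<δ)
  e : ℚ
  e = δ ℚ.* toℚ (d * n)
  0≤e : 0ℚ ℚ.≤ e
  0≤e = subst (ℚ._≤ e) (ℚP.*-zeroʳ δ) (ℚP.*-monoˡ-≤-nonNeg δ (toℚ-mono-≤ {0} {d * n} z≤n))
  T : ℕ
  T = sumᶠ (λ i → ∣ a i - b i ∣) * (k * d)
  T≤e : toℚ T ℚ.≤ δ ℚ.* toℚ n → toℚ T ℚ.≤ e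
  T≤e T≤δn = ℚP.≤-trans T≤δn (ℚP.*-monoˡ-≤-nonNeg δ (toℚ-mono-≤ (ℕP.m≤n*m n d {{ℕ.>-nonZero 0<d}})))
  aligned : ∃ λ π → 2 * diffUnder P F′ π ≤ T
  aligned = small-components-align d R P F′ boundedP boundedF′
              (MaxDeg≤-⊆ {X = G} {P} P⊆G degG) (MaxDeg≤-⊆ {X = F} {F′} F′⊆F (degΠ F ΠF)) a b countsP countsF′
  π : Permutation n n
  π = proj₁ aligned
  X A Y B : ℕ
  X = diffUnder G F π
  A = countPairs (deletions G P)
  Y = diffUnder P F′ π
  B = countPairs (deletions F F′)
  X≤A+Y+B : X ≤ A + Y + B
  X≤A+Y+B = subst₂ (λ A′ B′ → X ≤ A′ + Y + B′) (diffUnder-id-⊆ G P P⊆G) (diffUnder-id-⊆ F F′ F′⊆F)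
              (diffUnder-triangle G P F′ F π)
  X+X≤ : X + X ≤ (A + A) + T + (B + B)
  X+X≤ = begin
    X + X
      ≤⟨ ℕP.+-mono-≤ X≤A+Y+B X≤A+Y+B ⟩
    (A + Y + B) + (A + Y + B)
      ≡⟨ solve 3 (λ A Y B → (A :+ Y :+ B) :+ (A :+ Y :+ B) := (A :+ A) :+ con 2 :* Y :+ (B :+ B)) refl A Y B ⟩
    (A + A) + 2 * Y + (B + B)
      ≤⟨ ℕP.+-monoˡ-≤ (B + B) (ℕP.+-monoʳ-≤ (A + A) (proj₂ aligned)) ⟩
    (A + A) + T + (B + B)
      ∎
    where
    open ℕP.≤-Reasoning
    open ℕ-Solver

lemma2p5 : (n d k : ℕ) → 0 < n → 0 < d → 0 < k →
    (ε : ℚ) → 0ℚ ℚ.< ε →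
    (Π : Property n) → (∀ H → Π H → MaxDeg≤ d H × Planar H) →
    (G : Graph n) → MaxDeg≤ d G →
    (P : Graph n) → IsPartition ε d k G P →
    ((G ∈Π Π →
       ∃ λ F → Π F × ∃ λ F' → IsPartition ε d k F F' × SameCnt k P F') ×
     (Far ((+ 3 / 1) ℚ.* ε) d Π G →
       ∀ F → Π F → ∀ F' → IsPartition ε d k F F' →
         L1DistGreater k P F' (ε ℚ.* toℚ n) (k * d)))
lemma2p5 n d k _ 0<d _ δ 0<δ Π members G degG P partition =
  member⇒same-counts {n} {δ} {d} {k} {Π} {G} {P} partition ,
  far⇒counts-far {n} {d} {k} {δ} 0<δ 0<d (λ H ΠH → proj₁ (members H ΠH)) {G} {P} degG partition
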